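{- For any pair of connected bipartite graphs $G$ and $H$ (each with at least two vertices), the following are equivalent: (1) $G$ and $H$ have the same size parameter; (2) $|\mathrm{Hom}(G,K_{1,2})| = |\mathrm{Hom}(H,K_{1,2})|$; (3) $|\mathrm{Hom}(G,T)| = |\mathrm{Hom}(H,T)|$ for every tree $T$ of diameter at most $2$.
   Context: All graphs are finite, simple and undirected. $\mathrm{Hom}(G,H)$ is the set of homomorphisms from $G$ to $H$. $K_{1,p}$ is the complete bipartite graph with parts of sizes $1$ and $p$. A tree is a connected acyclic graph; the diameter of a connected graph is the least $p$ such that any two distinct vertices are joined by a path of length at most $p$. The size parameter of a connected bipartite graph with at least two vertices is the pair $(m,n)$ of positive integers with $m\le n$ such that the two parts of its bipartition have $m$ and $n$ vertices respectively. -}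

module Defs where

open import Data.Bool using (Bool; true; false; T)
open import Data.Nat using (ℕ; zero; suc; _≤_)
open import Data.Fin using (Fin; zero; suc; inject₁; fromℕ)
open import Data.Fin.Properties using (all?)
open import Data.Vec using (Vec; []; _∷_; lookup)
open import Data.List using (List; []; _∷_; map; concatMap; length; filter; allFin)
open import Data.Product using (Σ; ∃; _×_; _,_)
open import Function.Definitions using (Injective)
open import Relation.Nullary using (¬_; Dec)
open import Relation.Nullary.Decidable using (T?; _→-dec_)
open import Relation.Binary.PropositionalEquality using (_≡_; _≢_)

record Graph : Set where
  field
    n      : ℕ
    adj    : Fin n → Fin n → Bool
    sym    : ∀ u v → adj u v ≡ adj v u
    irrefl : ∀ u → adj u u ≡ false

open Graph public

Adj : (G : Graph) → Fin (n G) → Fin (n G) → Set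
Adj G u v = T (adj G u v)

IsHom : (G H : Graph) → Vec (Fin (n H)) (n G) → Set
IsHom G H f = ∀ u v → Adj G u v → Adj H (lookup f u) (lookup f v)

isHom? : (G H : Graph) → (f : Vec (Fin (n H)) (n G)) → Dec (IsHom G H f)
isHom? G H f = all? λ u → all? λ v →
  T? (adj G u v) →-dec T? (adj H (lookup f u) (lookup f v))

-- All maps Fin k → Fin m, as vectors (each appearing exactly once).
allMaps : (k m : ℕ) → List (Vec (Fin m) k)
allMaps zero    m = [] ∷ []
allMaps (suc k) m = concatMap (λ i → map (i ∷_) (allMaps k m)) (allFin m)

homCount : Graph → Graph → ℕ
homCount G H = length (filter (isHom? G H) (allMaps (n G) (n H)))

data Walk (G : Graph) : ℕ → Fin (n G) → Fin (n G) → Set where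
  [] : ∀ {u} → Walk G 0 u u
  _∷_ : ∀ {k u w v} → Adj G u w → Walk G k w v → Walk G (suc k) u v

Connected : Graph → Set
Connected G = ∀ u v → ∃ λ k → Walk G k u v

Cycle : Graph → Set
Cycle G = Σ ℕ λ k → Σ (Fin (suc (suc (suc k))) → Fin (n G)) λ c →
  Injective _≡_ _≡_ c
  × (∀ (i : Fin (suc (suc k))) → Adj G (c (inject₁ i)) (c (suc i)))
  × Adj G (c (fromℕ (suc (suc k)))) (c zero)

Acyclic : Graph → Set
Acyclic G = ¬ Cycle G

IsTree : Graph → Set
IsTree G = Connected G × Acyclic G

-- diameter ≤ p: distinct vertices are joined by a walk (equivalently a path)
-- of length at most p.
DiamAtMost : Graph → ℕ → Set
DiamAtMost G p = ∀ u v → u ≢ v → ∃ λ k → k ≤ p × Walk G k u v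

Proper2Col : (G : Graph) → (Fin (n G) → Bool) → Set
Proper2Col G c = ∀ u v → Adj G u v → c u ≢ c v

Bipartite : Graph → Set
Bipartite G = ∃ λ c → Proper2Col G c

colourCount : ∀ {k} → (Fin k → Bool) → Bool → ℕ
colourCount {k} c b = length (filter (λ u → c u Data.Bool.≟ b) (allFin k))
  where import Data.Bool

SizeParam : Graph → ℕ → ℕ → Set
SizeParam G m m' = m ≤ m' × Σ (Fin (n G) → Bool) λ c →
  Proper2Col G c × colourCount c false ≡ m × colourCount c true ≡ m'

SameSizeParam : Graph → Graph → Set
SameSizeParam G H = ∃ λ m → ∃ λ m' → SizeParam G m m' × SizeParam H m m'

k1adj : ∀ {p} → Fin (suc p) → Fin (suc p) → Bool
k1adj zero    zero    = false
k1adj zero    (suc _) = true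
k1adj (suc _) zero    = true
k1adj (suc _) (suc _) = false

K1 : ℕ → Graph
K1 p = record { n = suc p ; adj = k1adj ; sym = s ; irrefl = i }
  where
  s : ∀ u v → k1adj u v ≡ k1adj v u
  s zero zero = Relation.Binary.PropositionalEquality.refl
  s zero (suc _) = Relation.Binary.PropositionalEquality.refl
  s (suc _) zero = Relation.Binary.PropositionalEquality.refl
  s (suc _) (suc _) = Relation.Binary.PropositionalEquality.refl
  i : ∀ u → k1adj u u ≡ false
  i zero = Relation.Binary.PropositionalEquality.refl
  i (suc _) = Relation.Binary.PropositionalEquality.refl

{-# OPTIONS --safe #-}
module Submission where

-- A map f from G to a star with centre z is a homomorphism exactly when "f u is the centre" is a proper
-- 2-colouring of G. A connected bipartite graph has just two proper 2-colourings, c and not ∘ c, and the maps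
-- inducing a given one are counted factor by factor; so for the star K_{1,p} and the size parameter (m, m′),
-- |Hom(G, K_{1,p})| = p^m + p^m′. A tree of diameter at most two is empty or a star (C₃, C₄ and C₅ are the
-- obstructions), which gives (1) ⇒ (3); (3) ⇒ (2) takes T = K_{1,2}; and (2) ⇒ (1) holds because
-- 2^m + 2^m′ with m ≤ m′ determines m and m′.

open import Defs hiding (sym)
open import Data.Bool using (Bool; true; false; not; _∧_; _∨_; if_then_else_; T)
open import Data.Bool.Properties using (¬-not; not-¬; not-injective) renaming (_≟_ to _≟ᵇ_)
open import Data.Empty using (⊥; ⊥-elim)
open import Data.Fin using (Fin; zero; suc; inject₁; fromℕ; fromℕ<; _≟_)
open import Data.Fin.Properties using (all?; ¬∀⟶∃¬; ∀-cons-⇔)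
open import Data.List using (List; []; _∷_; _++_; map; concatMap; length; filter; tabulate; allFin)
open import Data.List.Properties using (map-tabulate; tabulate-cong; length-tabulate)
open import Data.Nat using (ℕ; zero; suc; _+_; _*_; _∸_; _^_; _≤_; z≤n; s≤s)
open import Data.Nat.ListAction using (product)
open import Data.Nat.Properties
  using (+-suc; suc-injective; ≤-total; ≤-trans; <-cmp; <⇒≢; +-mono-≤; *-assoc; *-identityˡ; *-cancelˡ-≡;
         *-distribˡ-+; ^-zeroˡ; ^-monoʳ-<; m^n>0; even≢odd; *-commutativeSemigroup)
open import Data.Product using (∃; ∃₂; _×_; _,_; proj₁; proj₂)
open import Data.Sum using (_⊎_; inj₁; inj₂; [_,_]′)
open import Data.Unit using (tt)
open import Data.Vec using (Vec; []; _∷_; lookup)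
open import Data.Vec.Relation.Unary.All using ([]; _∷_)
open import Data.Vec.Relation.Unary.AllPairs using ([]; _∷_)
open import Data.Vec.Relation.Unary.Unique.Propositional using (Unique)
open import Data.Vec.Relation.Unary.Unique.Propositional.Properties using (lookup-injective)
open import Function using (_∘_; id)
open import Function.Bundles using (_⇔_; mk⇔; Equivalence)
open import Function.Construct.Composition using (_⇔-∘_)
open import Relation.Binary.PropositionalEquality
  using (_≡_; _≢_; _≗_; refl; sym; trans; cong; cong₂; subst; subst₂; ≢-sym; module ≡-Reasoning)
open import Relation.Binary.Definitions using (tri<; tri≈; tri>)
open import Relation.Nullary using (¬_; Dec; yes; no; does; contradiction)
open import Relation.Nullary.Decidable using (dec-false; does-⇔; decidable-stable; T?; _×-dec_; _⊎-dec_)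
import Relation.Nullary.Decidable as Dec
open import Algebra.Properties.CommutativeSemigroup *-commutativeSemigroup using (x∙yz≈y∙xz)

private
  variable
    A B : Set

count : (A → Bool) → List A → ℕ
count p []       = 0
count p (x ∷ xs) = if p x then suc (count p xs) else count p xs

countOf : Bool → List Bool → ℕ
countOf b = count (λ x → does (x ≟ᵇ b))

length-filter≡count : {P : A → Set} (P? : ∀ x → Dec (P x)) (xs : List A) →
                      length (filter P? xs) ≡ count (does ∘ P?) xs
length-filter≡count P? []       = refl
length-filter≡count P? (x ∷ xs) with does (P? x)
... | true  = cong suc (length-filter≡count P? xs)
... | false = length-filter≡count P? xs

count-cong : {p q : A → Bool} → p ≗ q → count p ≗ count q
count-cong p≗q []       = refl
count-cong p≗q (x ∷ xs) rewrite p≗q x = cong (λ n → if _ then suc n else n) (count-cong p≗q xs)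

count-false : (xs : List A) → count (λ _ → false) xs ≡ 0
count-false []       = refl
count-false (x ∷ xs) = count-false xs

count-∧ˡ : ∀ b (p : A → Bool) xs → count (λ x → b ∧ p x) xs ≡ (if b then count p xs else 0)
count-∧ˡ true  p xs = refl
count-∧ˡ false p xs = count-false xs

count-++ : ∀ (p : A → Bool) xs ys → count p (xs ++ ys) ≡ count p xs + count p ys
count-++ p []       ys = refl
count-++ p (x ∷ xs) ys with p x
... | true  = cong suc (count-++ p xs ys)
... | false = count-++ p xs ys

count-∨ : {p q : A → Bool} → (∀ x → p x ≡ true → q x ≡ false) →
          ∀ xs → count (λ x → p x ∨ q x) xs ≡ count p xs + count q xs
count-∨ disj [] = refl
count-∨ {p = p} {q = q} disj (x ∷ xs) with p x in px | q x in qx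
... | true  | true  = contradiction (trans (sym qx) (disj x px)) λ ()
... | true  | false = cong suc (count-∨ disj xs)
... | false | true  = trans (cong suc (count-∨ disj xs)) (sym (+-suc _ _))
... | false | false = count-∨ disj xs

count-map : (p : B → Bool) (f : A → B) → ∀ xs → count p (map f xs) ≡ count (p ∘ f) xs
count-map p f []       = refl
count-map p f (x ∷ xs) = cong (λ n → if p (f x) then suc n else n) (count-map p f xs)

count-concatMap : (p : B → Bool) (q : A → Bool) (g : A → List B) (C : ℕ) →
                  (∀ x → count p (g x) ≡ (if q x then C else 0)) →
                  ∀ xs → count p (concatMap g xs) ≡ count q xs * C
count-concatMap p q g C fibre []       = refl
count-concatMap p q g C fibre (x ∷ xs) =
  trans (count-++ p (g x) _) (trans (cong₂ _+_ (fibre x) (count-concatMap p q g C fibre xs)) (step (q x)))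
  where
  step : ∀ b → (if b then C else 0) + count q xs * C ≡ (if b then suc (count q xs) else count q xs) * C
  step true  = refl
  step false = refl

count-tabulate : {k : ℕ} (p : A → Bool) (g : Fin k → A) → count p (tabulate g) ≡ count (p ∘ g) (allFin k)
count-tabulate p g = trans (cong (count p) (sym (map-tabulate id g))) (count-map p g (allFin _))

countOf-true+false : ∀ bs → countOf true bs + countOf false bs ≡ length bs
countOf-true+false []           = refl
countOf-true+false (true ∷ bs)  = cong suc (countOf-true+false bs)
countOf-true+false (false ∷ bs) = trans (+-suc _ _) (cong suc (countOf-true+false bs))

countOf-indicator : ∀ {N} (z : Fin N) → countOf true (tabulate λ i → does (i ≟ z)) ≡ 1
countOf-indicator {suc N} zero    =
  cong suc (trans (count-tabulate {k = N} (λ x → does (x ≟ᵇ true)) (λ _ → false)) (count-false (allFin N)))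
countOf-indicator {suc N} (suc z) = countOf-indicator z

product-map : (h : Bool → ℕ) (bs : List Bool) →
              product (map h bs) ≡ h true ^ countOf true bs * h false ^ countOf false bs
product-map h []           = refl
product-map h (true ∷ bs)  = trans (cong (h true *_) (product-map h bs)) (sym (*-assoc (h true) _ _))
product-map h (false ∷ bs) =
  trans (cong (h false *_) (product-map h bs)) (x∙yz≈y∙xz (h false) (h true ^ countOf true bs) _)

-- Counting maps between finite sets

allAt? : ∀ {k} {P : Fin k → A → Set} → (∀ u x → Dec (P u x)) → (xs : Vec A k) → Dec (∀ u → P u (lookup xs u))
allAt? P? []       = yes λ ()
allAt? P? (x ∷ xs) = Dec.map ∀-cons-⇔ (P? zero x ×-dec allAt? (P? ∘ suc) xs)

count-allMaps : ∀ k N {P : Fin k → Fin N → Set} (P? : ∀ u i → Dec (P u i)) →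
                count (does ∘ allAt? P?) (allMaps k N) ≡ product (tabulate λ u → count (does ∘ P? u) (allFin N))
count-allMaps zero    N P? = refl
count-allMaps (suc k) N P? =
  trans (count-concatMap _ (does ∘ P? zero) _ _ fibre (allFin N))
        (cong (count (does ∘ P? zero) (allFin N) *_) (count-allMaps k N (P? ∘ suc)))
  where
  fibre : ∀ i → count (does ∘ allAt? P?) (map (i ∷_) (allMaps k N))
                ≡ (if does (P? zero i) then count (does ∘ allAt? (P? ∘ suc)) (allMaps k N) else 0)
  fibre i = trans (count-map _ (i ∷_) (allMaps k N)) (count-∧ˡ (does (P? zero i)) _ (allMaps k N))

colourCount≡countOf : ∀ {k} (c : Fin k → Bool) b → colourCount c b ≡ countOf b (tabulate c)
colourCount≡countOf {k} c b = trans (length-filter≡count (λ u → c u ≟ᵇ b) (allFin k)) (sym (count-tabulate _ c))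

colourCount-not : ∀ {k} (c : Fin k → Bool) b → colourCount (not ∘ c) b ≡ colourCount c (not b)
colourCount-not {k} c b = begin
  colourCount (not ∘ c) b                         ≡⟨ length-filter≡count (λ u → not (c u) ≟ᵇ b) (allFin k) ⟩
  count (λ u → does (not (c u) ≟ᵇ b)) (allFin k)  ≡⟨ count-cong (λ u → not-≟ (c u) b) (allFin k) ⟩
  count (λ u → does (c u ≟ᵇ not b)) (allFin k)    ≡⟨ length-filter≡count (λ u → c u ≟ᵇ not b) (allFin k) ⟨
  colourCount c (not b)                           ∎
  where
  open ≡-Reasoning
  not-≟ : ∀ x y → does (not x ≟ᵇ y) ≡ does (x ≟ᵇ not y)
  not-≟ true  true  = refl
  not-≟ true  false = refl
  not-≟ false true  = refl
  not-≟ false false = refl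

lifts? : ∀ {k N} (φ : Fin N → Bool) (c : Fin k → Bool) (f : Vec (Fin N) k) → Dec (φ ∘ lookup f ≗ c)
lifts? φ c = allAt? (λ u i → φ i ≟ᵇ c u)

count-lifts : ∀ {k N} (φ : Fin N → Bool) (c : Fin k → Bool) →
              count (does ∘ lifts? φ c) (allMaps k N)
              ≡ colourCount φ true ^ colourCount c true * colourCount φ false ^ colourCount c false
count-lifts {k} {N} φ c = begin
  count (does ∘ lifts? φ c) (allMaps k N)
    ≡⟨ count-allMaps k N _ ⟩
  product (tabulate λ u → count (λ i → does (φ i ≟ᵇ c u)) (allFin N))
    ≡⟨ cong product (tabulate-cong λ u → sym (length-filter≡count (λ i → φ i ≟ᵇ c u) (allFin N))) ⟩
  product (tabulate (colourCount φ ∘ c))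
    ≡⟨ cong product (sym (map-tabulate c (colourCount φ))) ⟩
  product (map (colourCount φ) (tabulate c))
    ≡⟨ product-map (colourCount φ) (tabulate c) ⟩
  colourCount φ true ^ countOf true (tabulate c) * colourCount φ false ^ countOf false (tabulate c)
    ≡⟨ sym (cong₂ (λ a b → colourCount φ true ^ a * colourCount φ false ^ b)
                  (colourCount≡countOf c true) (colourCount≡countOf c false)) ⟩
  colourCount φ true ^ colourCount c true * colourCount φ false ^ colourCount c false ∎
  where open ≡-Reasoning

-- Proper 2-colourings

module _ (G : Graph) where

  adj-irrefl : ∀ {x} → ¬ Adj G x x
  adj-irrefl {x} = subst T (irrefl G x)

  adj⇒≢ : ∀ {x y} → Adj G x y → x ≢ y
  adj⇒≢ a refl = adj-irrefl a

  adj-sym : ∀ {x y} → Adj G x y → Adj G y x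
  adj-sym {x} {y} = subst T (Graph.sym G x y)

  adj? : ∀ x y → Dec (Adj G x y)
  adj? x y = T? (adj G x y)

  proper2Col-resp : ∀ {c d} → d ≗ c → Proper2Col G c → Proper2Col G d
  proper2Col-resp d≗c pc u v a = subst₂ _≢_ (sym (d≗c u)) (sym (d≗c v)) (pc u v a)

  proper2Col-not : ∀ {c} → Proper2Col G c → Proper2Col G (not ∘ c)
  proper2Col-not pc u v a = pc u v a ∘ not-injective

  proper2Col-agree : ∀ {c d k u v} → Proper2Col G c → Proper2Col G d →
                     Walk G k u v → c u ≡ d u → c v ≡ d v
  proper2Col-agree pc pd []                e = e
  proper2Col-agree {c} {d} {u = u} pc pd (_∷_ {w = w} a walk) e =
    proper2Col-agree pc pd walk (begin
      c w        ≡⟨ ¬-not (≢-sym (pc u w a)) ⟩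
      not (c u)  ≡⟨ cong not e ⟩
      not (d u)  ≡⟨ sym (¬-not (≢-sym (pd u w a))) ⟩
      d w        ∎)
    where open ≡-Reasoning

  connected-proper2Col : Connected G → Fin (n G) → ∀ {c d} → Proper2Col G c →
                         Proper2Col G d ⇔ (d ≗ c ⊎ d ≗ not ∘ c)
  connected-proper2Col conn u₀ {c} {d} pc = mk⇔ to from
    where
    to : Proper2Col G d → d ≗ c ⊎ d ≗ not ∘ c
    to pd with d u₀ ≟ᵇ c u₀
    ... | yes e  = inj₁ λ u → proper2Col-agree pd pc (proj₂ (conn u₀ u)) e
    ... | no  ne = inj₂ λ u → proper2Col-agree pd (proper2Col-not pc) (proj₂ (conn u₀ u)) (¬-not ne)
    from : d ≗ c ⊎ d ≗ not ∘ c → Proper2Col G d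
    from (inj₁ d≗c)  = proper2Col-resp d≗c pc
    from (inj₂ d≗¬c) = proper2Col-resp d≗¬c (proper2Col-not pc)

-- Stars

record IsStarCentre (T : Graph) (z : Fin (n T)) : Set where
  field
    centre-adj     : ∀ v → v ≢ z → Adj T z v
    edge-at-centre : ∀ {u v} → Adj T u v → u ≡ z ⊎ v ≡ z

module StarCentre {T : Graph} {z : Fin (n T)} (star : IsStarCentre T z) where
  open IsStarCentre star

  isCentre : Fin (n T) → Bool
  isCentre i = does (i ≟ z)

  adj⇔isCentre≢ : ∀ {x y} → Adj T x y ⇔ isCentre x ≢ isCentre y
  adj⇔isCentre≢ {x} {y} = mk⇔ to from
    where
    to : Adj T x y → isCentre x ≢ isCentre y
    to a with x ≟ z | y ≟ z
    ... | yes refl | yes refl = λ _ → adj-irrefl T a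
    ... | yes _    | no  _    = λ ()
    ... | no  _    | yes _    = λ ()
    ... | no  x≢z  | no  y≢z  = λ _ → [ x≢z , y≢z ]′ (edge-at-centre a)
    from : isCentre x ≢ isCentre y → Adj T x y
    from with x ≟ z | y ≟ z
    ... | yes refl | yes refl = λ ne → contradiction refl ne
    ... | yes refl | no  y≢z  = λ _ → centre-adj y y≢z
    ... | no  x≢z  | yes refl = λ _ → adj-sym T (centre-adj x x≢z)
    ... | no  _    | no  _    = λ ne → contradiction refl ne

  hom⇔proper2Col : ∀ G f → IsHom G T f ⇔ Proper2Col G (isCentre ∘ lookup f)
  hom⇔proper2Col G f = mk⇔ (λ hom u v a → Equivalence.to adj⇔isCentre≢ (hom u v a))
                           (λ pc u v a → Equivalence.from adj⇔isCentre≢ (pc u v a))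

  centre-count : colourCount isCentre true ≡ 1
  centre-count = trans (colourCount≡countOf isCentre true) (countOf-indicator z)

  leaf-count : colourCount isCentre false ≡ n T ∸ 1
  leaf-count = trans (colourCount≡countOf isCentre false) (cong (_∸ 1) (begin
    1 + countOf false (tabulate isCentre)
      ≡⟨ cong (_+ countOf false (tabulate isCentre)) (countOf-indicator z) ⟨
    countOf true (tabulate isCentre) + countOf false (tabulate isCentre)
      ≡⟨ countOf-true+false (tabulate isCentre) ⟩
    length (tabulate isCentre)
      ≡⟨ length-tabulate isCentre ⟩
    n T ∎))
    where open ≡-Reasoning

  count-lifts-isCentre : ∀ {k} (c : Fin k → Bool) →
                         count (does ∘ lifts? isCentre c) (allMaps k (n T)) ≡ (n T ∸ 1) ^ colourCount c false
  count-lifts-isCentre c = begin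
    count (does ∘ lifts? isCentre c) (allMaps _ (n T))
      ≡⟨ count-lifts isCentre c ⟩
    colourCount isCentre true ^ colourCount c true * colourCount isCentre false ^ colourCount c false
      ≡⟨ cong₂ (λ a b → a ^ colourCount c true * b ^ colourCount c false) centre-count leaf-count ⟩
    1 ^ colourCount c true * (n T ∸ 1) ^ colourCount c false
      ≡⟨ cong (_* (n T ∸ 1) ^ colourCount c false) (^-zeroˡ (colourCount c true)) ⟩
    1 * (n T ∸ 1) ^ colourCount c false
      ≡⟨ *-identityˡ _ ⟩
    (n T ∸ 1) ^ colourCount c false ∎
    where open ≡-Reasoning

  homCount-star : ∀ G → Connected G → Fin (n G) → ∀ c → Proper2Col G c →
                  homCount G T ≡ (n T ∸ 1) ^ colourCount c false + (n T ∸ 1) ^ colourCount c true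
  homCount-star G conn u₀ c pc = begin
    homCount G T
      ≡⟨ length-filter≡count (isHom? G T) maps ⟩
    count (does ∘ isHom? G T) maps
      ≡⟨ count-cong (λ f → does-⇔ (hom⇔lifts f) (isHom? G T f) (lifts? isCentre c f ⊎-dec lifts? isCentre (not ∘ c) f)) maps ⟩
    count (λ f → does (lifts? isCentre c f) ∨ does (lifts? isCentre (not ∘ c) f)) maps
      ≡⟨ count-∨ disjoint maps ⟩
    count (does ∘ lifts? isCentre c) maps + count (does ∘ lifts? isCentre (not ∘ c)) maps
      ≡⟨ cong₂ _+_ (count-lifts-isCentre c) (count-lifts-isCentre (not ∘ c)) ⟩
    (n T ∸ 1) ^ colourCount c false + (n T ∸ 1) ^ colourCount (not ∘ c) false
      ≡⟨ cong (λ m → (n T ∸ 1) ^ colourCount c false + (n T ∸ 1) ^ m) (colourCount-not c false) ⟩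
    (n T ∸ 1) ^ colourCount c false + (n T ∸ 1) ^ colourCount c true ∎
    where
    open ≡-Reasoning
    maps : List (Vec (Fin (n T)) (n G))
    maps = allMaps (n G) (n T)
    hom⇔lifts : ∀ f → IsHom G T f ⇔ (isCentre ∘ lookup f ≗ c ⊎ isCentre ∘ lookup f ≗ not ∘ c)
    hom⇔lifts f = connected-proper2Col G conn u₀ pc ⇔-∘ hom⇔proper2Col G f
    disjoint : ∀ f → does (lifts? isCentre c f) ≡ true → does (lifts? isCentre (not ∘ c) f) ≡ false
    disjoint f with lifts? isCentre c f
    ... | yes l = λ _ → dec-false (lifts? isCentre (not ∘ c) f) λ l′ → not-¬ refl (trans (sym (l u₀)) (l′ u₀))
    ... | no  _ = λ ()

-- Trees of diameter at most two are stars

cycle : ∀ (G : Graph) {k} (vs : Vec (Fin (n G)) (3 + k)) → Unique vs →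
        (∀ i → Adj G (lookup vs (inject₁ i)) (lookup vs (suc i))) →
        Adj G (lookup vs (fromℕ (2 + k))) (lookup vs zero) → Cycle G
cycle G vs distinct edges closing = _ , lookup vs , lookup-injective distinct _ _ , edges , closing

module _ {T : Graph} (acyclic : Acyclic T) where

  no-triangle : ∀ {a b c} → Adj T a b → Adj T b c → Adj T c a → ⊥
  no-triangle ab bc ca = acyclic (cycle T (_ ∷ _ ∷ _ ∷ [])
    ((adj⇒≢ T ab ∷ ≢-sym (adj⇒≢ T ca) ∷ []) ∷ (adj⇒≢ T bc ∷ []) ∷ [] ∷ [])
    (λ { zero → ab ; (suc zero) → bc }) ca)

  no-square : ∀ {a b c d} → a ≢ c → b ≢ d → Adj T a b → Adj T b c → Adj T c d → Adj T d a → ⊥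
  no-square a≢c b≢d ab bc cd da = acyclic (cycle T (_ ∷ _ ∷ _ ∷ _ ∷ [])
    ((adj⇒≢ T ab ∷ a≢c ∷ ≢-sym (adj⇒≢ T da) ∷ []) ∷ (adj⇒≢ T bc ∷ b≢d ∷ []) ∷ (adj⇒≢ T cd ∷ []) ∷ [] ∷ [])
    (λ { zero → ab ; (suc zero) → bc ; (suc (suc zero)) → cd }) da)

  no-pentagon : ∀ {a b c d e} → a ≢ c → a ≢ d → b ≢ d → b ≢ e → c ≢ e →
                Adj T a b → Adj T b c → Adj T c d → Adj T d e → Adj T e a → ⊥
  no-pentagon a≢c a≢d b≢d b≢e c≢e ab bc cd de ea = acyclic (cycle T (_ ∷ _ ∷ _ ∷ _ ∷ _ ∷ [])
    ((adj⇒≢ T ab ∷ a≢c ∷ a≢d ∷ ≢-sym (adj⇒≢ T ea) ∷ []) ∷ (adj⇒≢ T bc ∷ b≢d ∷ b≢e ∷ []) ∷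
     (adj⇒≢ T cd ∷ c≢e ∷ []) ∷ (adj⇒≢ T de ∷ []) ∷ [] ∷ [])
    (λ { zero → ab ; (suc zero) → bc ; (suc (suc zero)) → cd ; (suc (suc (suc zero))) → de }) ea)

  universal⇒starCentre : ∀ {z} → (∀ v → v ≢ z → Adj T z v) → IsStarCentre T z
  universal⇒starCentre {z} universal = record { centre-adj = universal ; edge-at-centre = at-centre }
    where
    at-centre : ∀ {u v} → Adj T u v → u ≡ z ⊎ v ≡ z
    at-centre {u} {v} uv with u ≟ z | v ≟ z
    ... | yes u≡z | _        = inj₁ u≡z
    ... | no  _   | yes v≡z  = inj₂ v≡z
    ... | no  u≢z | no  v≢z  = ⊥-elim (no-triangle (universal u u≢z) uv (adj-sym T (universal v v≢z)))

  module _ (diam : DiamAtMost T 2) where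

    within-two : ∀ {u v} → u ≢ v → Adj T u v ⊎ ∃ λ w → Adj T u w × Adj T w v
    within-two {u} {v} u≢v with diam u v u≢v
    ... | 0 , _ , []                       = contradiction refl u≢v
    ... | 1 , _ , uv ∷ []                  = inj₁ uv
    ... | 2 , _ , uw ∷ wv ∷ []             = inj₂ (_ , uw , wv)
    ... | suc (suc (suc _)) , s≤s (s≤s ()) , _

    -- Otherwise the paths of length two from x to o and to w close a triangle or a pentagon with ow.
    edge-dominating : ∀ {o w x} → Adj T o w → x ≢ o → x ≢ w → ¬ Adj T x o → ¬ Adj T x w → ⊥
    edge-dominating {o} {w} {x} ow x≢o x≢w ¬xo ¬xw with within-two x≢o | within-two x≢w
    ... | inj₁ xo             | _                    = ¬xo xo
    ... | _                   | inj₁ xw              = ¬xw xw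
    ... | inj₂ (y , xy , yo)  | inj₂ (t , xt , tw)   =
      no-pentagon x≢o x≢w y≢w y≢t o≢t xy yo ow (adj-sym T tw) (adj-sym T xt)
      where
      y≢w : y ≢ w
      y≢w refl = ¬xw xy
      y≢t : y ≢ t
      y≢t refl = no-triangle yo ow (adj-sym T tw)
      o≢t : o ≢ t
      o≢t refl = ¬xo xt

    starCentre-exists : Fin (n T) → ∃ (IsStarCentre T)
    starCentre-exists o with all? (λ v → v ≟ o ⊎-dec adj? T o v)
    ... | yes near = o , universal⇒starCentre λ v v≢o → [ (λ v≡o → contradiction v≡o v≢o) , id ]′ (near v)
    ... | no ¬near with ¬∀⟶∃¬ _ _ (λ v → v ≟ o ⊎-dec adj? T o v) ¬near
    ... | v , far with within-two {o} {v} (λ o≡v → far (inj₁ (sym o≡v)))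
    ... | inj₁ ov            = contradiction (inj₂ ov) far
    ... | inj₂ (w , ow , wv) = w , universal⇒starCentre universal
      where
      -- A vertex x missed by w would have to see o (by the edge ow) and then v (by the edge wv),
      -- closing the square x o w v.
      universal : ∀ x → x ≢ w → Adj T w x
      universal x x≢w = decidable-stable (adj? T w x) λ ¬wx →
        let ¬xw = ¬wx ∘ adj-sym T
            x≢o = λ { refl → ¬wx (adj-sym T ow) }
            ¬xo = λ xo → edge-dominating wv x≢w (λ { refl → far (inj₂ (adj-sym T xo)) }) ¬xw
                                         (λ xv → no-square x≢w (λ { refl → far (inj₁ refl) }) xo ow wv (adj-sym T xv))
        in edge-dominating ow x≢o x≢w ¬xo ¬xw

-- Stars are trees of diameter at most two

cycle-successor-of-c₂ : ∀ (G : Graph) k (c : Fin (3 + k) → Fin (n G)) →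
                        (∀ i → Adj G (c (inject₁ i)) (c (suc i))) → Adj G (c (fromℕ (2 + k))) (c zero) →
                        ∃ λ j → j ≢ suc zero × Adj G (c (suc (suc zero))) (c j)
cycle-successor-of-c₂ G zero    c edges closing = zero , (λ ()) , closing
cycle-successor-of-c₂ G (suc k) c edges closing = suc (suc (suc zero)) , (λ ()) , edges (suc (suc zero))

module _ {T : Graph} {z : Fin (n T)} (star : IsStarCentre T z) where
  open IsStarCentre star

  starCentre⇒diam≤2 : DiamAtMost T 2
  starCentre⇒diam≤2 u v u≢v with u ≟ z | v ≟ z
  ... | yes refl | _        = 1 , s≤s z≤n , centre-adj v (≢-sym u≢v) ∷ []
  ... | no  _    | yes refl = 1 , s≤s z≤n , adj-sym T (centre-adj u u≢v) ∷ []
  ... | no  u≢z  | no  v≢z  = 2 , s≤s (s≤s z≤n) , adj-sym T (centre-adj u u≢z) ∷ centre-adj v v≢z ∷ []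

  starCentre⇒connected : Connected T
  starCentre⇒connected u v with u ≟ v
  ... | yes refl = 0 , []
  ... | no  u≢v  = let k , _ , walk = starCentre⇒diam≤2 u v u≢v in k , walk

  -- In a cycle c₀ c₁ c₂ …, the edges c₀c₁ and c₁c₂ force c₁ = z; then the edge leaving c₂ would have
  -- to return to z = c₁.
  starCentre⇒acyclic : Acyclic T
  starCentre⇒acyclic (k , c , injective , edges , closing)
    with edge-at-centre (edges zero) | edge-at-centre (edges (suc zero))
  ... | inj₁ c₀≡z | inj₂ c₂≡z = contradiction (injective (trans c₀≡z (sym c₂≡z))) λ ()
  ... | inj₂ c₁≡z | inj₂ c₂≡z = contradiction (injective (trans c₁≡z (sym c₂≡z))) λ ()
  ... | _         | inj₁ c₁≡z with cycle-successor-of-c₂ T k c edges closing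
  ...   | j , j≢1 , c₂cⱼ with edge-at-centre c₂cⱼ
  ...     | inj₁ c₂≡z = contradiction (injective (trans c₁≡z (sym c₂≡z))) λ ()
  ...     | inj₂ cⱼ≡z = j≢1 (injective (trans cⱼ≡z (sym c₁≡z)))

K1-starCentre : ∀ p → IsStarCentre (K1 p) zero
K1-starCentre p = record { centre-adj = centre-adj ; edge-at-centre = edge-at-centre }
  where
  centre-adj : ∀ v → v ≢ zero → Adj (K1 p) zero v
  centre-adj zero    v≢0 = contradiction refl v≢0
  centre-adj (suc v) _   = tt
  edge-at-centre : ∀ {u v} → Adj (K1 p) u v → u ≡ zero ⊎ v ≡ zero
  edge-at-centre {zero}            _ = inj₁ refl
  edge-at-centre {suc _} {zero}    _ = inj₂ refl
  edge-at-centre {suc _} {suc _}   ()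

-- Size parameters

bipartite⇒sizeParam : ∀ G → Bipartite G → ∃₂ (SizeParam G)
bipartite⇒sizeParam G (c , pc) with ≤-total (colourCount c false) (colourCount c true)
... | inj₁ f≤t = _ , _ , f≤t , c , pc , refl , refl
... | inj₂ t≤f = _ , _ , t≤f , not ∘ c , proper2Col-not G pc , colourCount-not c false , colourCount-not c true

homCount-sizeParam : ∀ {T z} → IsStarCentre T z → ∀ {G} → Connected G → Fin (n G) → ∀ {m m′} → SizeParam G m m′ →
                     homCount G T ≡ (n T ∸ 1) ^ m + (n T ∸ 1) ^ m′
homCount-sizeParam star {G} conn u₀ (_ , c , pc , refl , refl) = StarCentre.homCount-star star G conn u₀ c pc

homCount-into-empty : ∀ G T → Fin (n G) → n T ≡ 0 → homCount G T ≡ 0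
homCount-into-empty G T u n≡0 = cong (length ∘ filter (isHom? G T)) (no-maps u n≡0)
  where
  no-maps : ∀ {k m} → Fin k → m ≡ 0 → allMaps k m ≡ []
  no-maps {suc k} _ refl = refl

2^-injective : ∀ {a b} → 2 ^ a ≡ 2 ^ b → a ≡ b
2^-injective {a} {b} e with <-cmp a b
... | tri< a<b _ _ = contradiction e (<⇒≢ (^-monoʳ-< 2 (s≤s (s≤s z≤n)) a<b))
... | tri≈ _ a≡b _ = a≡b
... | tri> _ _ b<a = contradiction (sym e) (<⇒≢ (^-monoʳ-< 2 (s≤s (s≤s z≤n)) b<a))

1+2^b≢2^[1+c]+2^[1+d] : ∀ b c d → 1 + 2 ^ b ≢ 2 ^ suc c + 2 ^ suc d
1+2^b≢2^[1+c]+2^[1+d] zero    c d e =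
  <⇒≢ (+-mono-≤ (m^n>0 2 c) (m^n>0 2 d)) (*-cancelˡ-≡ 1 _ 2 (trans e (sym (*-distribˡ-+ 2 (2 ^ c) (2 ^ d)))))
1+2^b≢2^[1+c]+2^[1+d] (suc b) c d e = even≢odd (2 ^ c + 2 ^ d) (2 ^ b) (trans (*-distribˡ-+ 2 (2 ^ c) (2 ^ d)) (sym e))

2^+2^-injective : ∀ {a b c d} → a ≤ b → c ≤ d → 2 ^ a + 2 ^ b ≡ 2 ^ c + 2 ^ d → a ≡ c × b ≡ d
2^+2^-injective {zero}  {b}     {zero}  {d}     _         _         e = refl , 2^-injective (suc-injective e)
2^+2^-injective {zero}  {b}     {suc c} {suc d} _         _         e = contradiction e (1+2^b≢2^[1+c]+2^[1+d] b c d)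
2^+2^-injective {suc a} {suc b} {zero}  {d}     _         _         e = contradiction (sym e) (1+2^b≢2^[1+c]+2^[1+d] d a b)
2^+2^-injective {suc a} {suc b} {suc c} {suc d} (s≤s a≤b) (s≤s c≤d) e =
  let a≡c , b≡d = 2^+2^-injective a≤b c≤d halved in cong suc a≡c , cong suc b≡d
  where
  open ≡-Reasoning
  halved : 2 ^ a + 2 ^ b ≡ 2 ^ c + 2 ^ d
  halved = *-cancelˡ-≡ _ _ 2 (begin
    2 * (2 ^ a + 2 ^ b)      ≡⟨ *-distribˡ-+ 2 (2 ^ a) (2 ^ b) ⟩
    2 ^ suc a + 2 ^ suc b    ≡⟨ e ⟩
    2 ^ suc c + 2 ^ suc d    ≡⟨ *-distribˡ-+ 2 (2 ^ c) (2 ^ d) ⟨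
    2 * (2 ^ c + 2 ^ d)      ∎)

vertex-or-empty : ∀ N → Fin N ⊎ N ≡ 0
vertex-or-empty zero    = inj₂ refl
vertex-or-empty (suc N) = inj₁ zero

sameSizeParam⇒homCount≡ : ∀ {G H} → Connected G → Connected H → Fin (n G) → Fin (n H) → SameSizeParam G H →
                          ∀ T → Acyclic T → DiamAtMost T 2 → homCount G T ≡ homCount H T
sameSizeParam⇒homCount≡ {G} {H} connG connH uG uH (_ , _ , sG , sH) T acyclic diam with vertex-or-empty (n T)
... | inj₂ n≡0 = trans (homCount-into-empty G T uG n≡0) (sym (homCount-into-empty H T uH n≡0))
... | inj₁ o   = let _ , star = starCentre-exists acyclic diam o
                 in trans (homCount-sizeParam star connG uG sG) (sym (homCount-sizeParam star connH uH sH))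

homCount-K₁₂≡⇒sameSizeParam : ∀ {G H} → Connected G → Connected H → Fin (n G) → Fin (n H) →
                              ∀ {m m′ k k′} → SizeParam G m m′ → SizeParam H k k′ →
                              homCount G (K1 2) ≡ homCount H (K1 2) → SameSizeParam G H
homCount-K₁₂≡⇒sameSizeParam {H = H} connG connH uG uH sG sH e =
  let m≡k , m′≡k′ = 2^+2^-injective (proj₁ sG) (proj₁ sH)
                      (trans (sym (homCount-sizeParam star connG uG sG)) (trans e (homCount-sizeParam star connH uH sH)))
  in _ , _ , sG , subst₂ (SizeParam H) (sym m≡k) (sym m′≡k′) sH
  where
  star : IsStarCentre (K1 2) zero
  star = K1-starCentre 2

theorem6 : (G H : Graph) →
    2 ≤ n G → 2 ≤ n H →
    Connected G → Connected H →
    Bipartite G → Bipartite H →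
    (SameSizeParam G H ⇔ (homCount G (K1 2) ≡ homCount H (K1 2)))
    × ((homCount G (K1 2) ≡ homCount H (K1 2)) ⇔
       ((T : Graph) → IsTree T → DiamAtMost T 2 → homCount G T ≡ homCount H T))
theorem6 G H 2≤G 2≤H connG connH bipG bipH = mk⇔ (3⇒2 ∘ 1⇒3) 2⇒1 , mk⇔ (1⇒3 ∘ 2⇒1) 3⇒2
  where
  uG : Fin (n G)
  uG = fromℕ< (≤-trans (s≤s z≤n) 2≤G)
  uH : Fin (n H)
  uH = fromℕ< (≤-trans (s≤s z≤n) 2≤H)
  1⇒3 : SameSizeParam G H → (T : Graph) → IsTree T → DiamAtMost T 2 → homCount G T ≡ homCount H T
  1⇒3 same T (_ , acyclic) = sameSizeParam⇒homCount≡ connG connH uG uH same T acyclic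
  3⇒2 : ((T : Graph) → IsTree T → DiamAtMost T 2 → homCount G T ≡ homCount H T) →
        homCount G (K1 2) ≡ homCount H (K1 2)
  3⇒2 trees = trees (K1 2) (starCentre⇒connected star , starCentre⇒acyclic star) (starCentre⇒diam≤2 star)
    where
    star : IsStarCentre (K1 2) zero
    star = K1-starCentre 2
  2⇒1 : homCount G (K1 2) ≡ homCount H (K1 2) → SameSizeParam G H
  2⇒1 = let _ , _ , sG = bipartite⇒sizeParam G bipG
            _ , _ , sH = bipartite⇒sizeParam H bipH
        in homCount-K₁₂≡⇒sameSizeParam connG connH uG uH sG sH
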